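{- In the setting described in the context, let $\Delta\in\Sigma$ and $\gamma\in G(\Delta)$ with $\gamma\ne 1$. Then: if $\mathcal{D}$ is of type 1, $|\mathrm{Fix}(\gamma)|\le(\lambda+2)\lambda$; if $\mathcal{D}$ is of type 2, $|\mathrm{Fix}(\gamma)|\le\lambda^2/2+\sqrt{\lambda^2/2-\lambda}$.
   Context: Setting: $\mathcal{D}=(\mathcal{P},\mathcal{B})$ is a non-trivial symmetric $2$-$(v,k,\lambda)$ design with $k>\lambda(\lambda-3)/2$ and $\lambda>10$; $G\le\mathrm{Aut}(\mathcal{D})$ is flag-transitive and point-imprimitive, and $\Sigma$ is a non-trivial $G$-invariant partition of $\mathcal{P}$ into $d$ classes of common size $c$. In this setting every block meets each class in $0$ or $2$ points and $\mathcal{D}$ is of one of two types: type 1 means $v=\lambda^2(\lambda+2)$, $k=\lambda(\lambda+1)$, $(c,d)=(\lambda+2,\lambda^2)$; type 2 means $v=\frac{\lambda+2}{2}\cdot\frac{\lambda^2-2\lambda+2}{2}$, $k=\lambda^2/2$, $(c,d)=\left(\frac{\lambda+2}{2},\frac{\lambda^2-2\lambda+2}{2}\right)$, with either $\lambda\equiv0\pmod 4$ or $\lambda=2w^2$, $w$ odd, $w\ge3$, $2(w^2-1)$ a square. $G(\Delta)$ is the pointwise stabilizer of $\Delta$ in $G$, and $\mathrm{Fix}(\gamma)$ is the set of points fixed by $\gamma$. -}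

module Defs where

open import Data.Nat using (ℕ; zero; suc; _+_; _*_; _∸_; _^_; _≤_; _<_; _/_)
open import Data.Nat.Divisibility using (_∣_)
open import Data.Bool using (Bool; true; false; _∧_; if_then_else_)
open import Data.Fin using (Fin; _≟_)
import Data.Fin as F
open import Data.Product using (Σ; ∃; _×_; _,_)
open import Data.Sum using (_⊎_)
open import Relation.Nullary using (¬_)
open import Relation.Nullary.Decidable using (⌊_⌋)
open import Relation.Binary.PropositionalEquality using (_≡_; _≢_; refl; cong; trans)
open import Function using (_∘_; id)

count : ∀ {n} → (Fin n → Bool) → ℕ
count {zero}  P = 0
count {suc n} P = (if P F.zero then 1 else 0) + count (P ∘ F.suc)

-- An incidence structure with point set Fin v and block set Fin v
-- (b = v: symmetric).  I p B = true means point p lies on block B.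
Incidence : ℕ → Set
Incidence v = Fin v → Fin v → Bool

record IsSymmetricDesign (v k lam : ℕ) (I : Incidence v) : Set where
  field
    blockSize : ∀ B → count (λ p → I p B) ≡ k
    pairCount : ∀ p q → p ≢ q → count (λ B → I p B ∧ I q B) ≡ lam

NonTrivial : ℕ → ℕ → Set
NonTrivial v k = 2 < k × suc k < v

record Aut {v : ℕ} (I : Incidence v) : Set where
  field
    pt     : Fin v → Fin v
    ptInv  : Fin v → Fin v
    blk    : Fin v → Fin v
    blkInv : Fin v → Fin v
    pt-inv₁  : ∀ x → pt (ptInv x) ≡ x
    pt-inv₂  : ∀ x → ptInv (pt x) ≡ x
    blk-inv₁ : ∀ x → blk (blkInv x) ≡ x
    blk-inv₂ : ∀ x → blkInv (blk x) ≡ x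
    preserves : ∀ p B → I (pt p) (blk B) ≡ I p B
open Aut public

module _ {v : ℕ} {I : Incidence v} where

  idAut : Aut I
  idAut = record { pt = id ; ptInv = id ; blk = id ; blkInv = id
                 ; pt-inv₁ = λ _ → refl ; pt-inv₂ = λ _ → refl
                 ; blk-inv₁ = λ _ → refl ; blk-inv₂ = λ _ → refl
                 ; preserves = λ _ _ → refl }

  _∘A_ : Aut I → Aut I → Aut I
  g ∘A h = record
    { pt = pt g ∘ pt h ; ptInv = ptInv h ∘ ptInv g
    ; blk = blk g ∘ blk h ; blkInv = blkInv h ∘ blkInv g
    ; pt-inv₁ = λ x → trans (cong (pt g) (pt-inv₁ h (ptInv g x))) (pt-inv₁ g x)
    ; pt-inv₂ = λ x → trans (cong (ptInv h) (pt-inv₂ g (pt h x))) (pt-inv₂ h x)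
    ; blk-inv₁ = λ x → trans (cong (blk g) (blk-inv₁ h (blkInv g x))) (blk-inv₁ g x)
    ; blk-inv₂ = λ x → trans (cong (blkInv h) (blk-inv₂ g (blk h x))) (blk-inv₂ h x)
    ; preserves = λ p B → trans (preserves g (pt h p) (blk h B)) (preserves h p B) }

  invA : Aut I → Aut I
  invA g = record
    { pt = ptInv g ; ptInv = pt g ; blk = blkInv g ; blkInv = blk g
    ; pt-inv₁ = pt-inv₂ g ; pt-inv₂ = pt-inv₁ g
    ; blk-inv₁ = blk-inv₂ g ; blk-inv₂ = blk-inv₁ g
    ; preserves = λ p B → trans
        (Relation.Binary.PropositionalEquality.sym
          (preserves g (ptInv g p) (blkInv g B)))
        (Relation.Binary.PropositionalEquality.cong₂ I (pt-inv₁ g p) (blk-inv₁ g B)) }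

record IsSubgroup {v : ℕ} {I : Incidence v} (G : Aut I → Set) : Set where
  field
    has-id  : G idAut
    has-∘   : ∀ {g h} → G g → G h → G (g ∘A h)
    has-inv : ∀ {g} → G g → G (invA g)

FlagTransitive : ∀ {v} {I : Incidence v} → (Aut I → Set) → Set
FlagTransitive {v} {I} G =
  ∀ p B p′ B′ → I p B ≡ true → I p′ B′ ≡ true →
  Σ (Aut I) λ g → G g × pt g p ≡ p′ × blk g B ≡ B′

-- a partition Σ of the points into d classes, each of size c,
-- given by the class map cls : points → Fin d
record IsPartition (v c d : ℕ) (cls : Fin v → Fin d) : Set where
  field
    classSize : ∀ δ → count (λ p → ⌊ cls p ≟ δ ⌋) ≡ c
    nontrivial : 1 < c × 1 < d

GInvariant : ∀ {v d} {I : Incidence v} → (Aut I → Set) → (Fin v → Fin d) → Set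
GInvariant {v} {d} {I} G cls =
  ∀ g → G g → ∀ p q → cls p ≡ cls q → cls (pt g p) ≡ cls (pt g q)

MeetsIn0or2 : ∀ {v d} → Incidence v → (Fin v → Fin d) → Set
MeetsIn0or2 I cls = ∀ B δ →
  let n = count (λ p → I p B ∧ ⌊ cls p ≟ δ ⌋) in n ≡ 0 ⊎ n ≡ 2

InPointwiseStab : ∀ {v d} {I : Incidence v} → (Aut I → Set) →
                  (Fin v → Fin d) → Fin d → Aut I → Set
InPointwiseStab G cls Δ γ = G γ × (∀ p → cls p ≡ Δ → pt γ p ≡ p)

NonIdentity : ∀ {v} {I : Incidence v} → Aut I → Set
NonIdentity γ = ¬ (∀ p → pt γ p ≡ p)

fixCount : ∀ {v} {I : Incidence v} → Aut I → ℕ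
fixCount γ = count (λ p → ⌊ pt γ p ≟ p ⌋)

Odd : ℕ → Set
Odd w = Σ ℕ λ t → w ≡ suc (2 * t)

IsSquare : ℕ → Set
IsSquare n = Σ ℕ λ s → n ≡ s * s

Type1 : (v k lam c d : ℕ) → Set
Type1 v k lam c d =
  v ≡ lam * lam * (lam + 2) × k ≡ lam * (lam + 1) × c ≡ lam + 2 × d ≡ lam * lam

-- type 2 parameters (all fractions cleared of denominators)
Type2 : (v k lam c d : ℕ) → Set
Type2 v k lam c d =
  4 * v ≡ (lam + 2) * ((lam * lam + 2) ∸ 2 * lam) ×
  2 * k ≡ lam * lam ×
  2 * c ≡ lam + 2 ×
  2 * d ≡ (lam * lam + 2) ∸ 2 * lam ×
  (4 ∣ lam ⊎
   Σ ℕ λ w → Odd w × 3 ≤ w × lam ≡ 2 * (w * w) × IsSquare (2 * (w * w ∸ 1)))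

-- f ≤ a + √m  for naturals f, a, m  ⟺  (f ∸ a)² ≤ m
LeqPlusSqrt : ℕ → ℕ → ℕ → Set
LeqPlusSqrt f a m = (f ∸ a) ^ 2 ≤ m

-- Let f be the number of fixed points of γ ≠ 1.  Counting the pairs (p, B) with p, γ p ∈ B once by
-- points and once by blocks shows that γ also fixes exactly f blocks; here one uses that any two
-- blocks meet in λ points, which follows from the variance of the numbers |B ∩ C|.  With
-- a_B = |Fix(γ) ∩ B| one has Σ a_B = k f and Σ a_B² = λ f² + (k - λ) f, and on a moved block
-- Fix(γ) ∩ B ⊆ B ∩ γ B, so a_B ≤ λ.  Cauchy–Schwarz over the fixed and over the moved blocks then
-- gives (f - k)² ≤ k - λ, through an explicit polynomial identity that uses λ (v - 1) = k (k - 1).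
-- For type 1, k - λ = λ², and for type 2, k = λ²/2.

module Submission where

open import Defs
open import Relation.Binary.PropositionalEquality

-- Polynomials in ℕ-valued atoms, evaluated in ℕ and in ℤ: an identity between naturals whose
-- proof needs subtraction is moved to ℤ, proved by the ring solver there, and moved back.
module IntegerArithmetic where
  open import Data.Nat as ℕ using (ℕ)
  open import Data.Integer using (ℤ; +_; _+_; _*_; _-_)
  open import Data.Integer.Properties using (pos-+; pos-*; +-injective; +-inverseʳ)
  open import Data.Integer.Tactic.RingSolver using (solve-∀)

  data Poly : Set where
    ‵_      : ℕ → Poly
    _⊕_ _⊗_ : Poly → Poly → Poly

  infixl 6 _⊕_
  infixl 7 _⊗_
  infix 8 ‵_

  ⟦_⟧ : Poly → ℕ
  ⟦ ‵ x   ⟧ = x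
  ⟦ a ⊕ b ⟧ = ⟦ a ⟧ ℕ.+ ⟦ b ⟧
  ⟦ a ⊗ b ⟧ = ⟦ a ⟧ ℕ.* ⟦ b ⟧

  ⟦_⟧ℤ : Poly → ℤ
  ⟦ ‵ x   ⟧ℤ = + x
  ⟦ a ⊕ b ⟧ℤ = ⟦ a ⟧ℤ + ⟦ b ⟧ℤ
  ⟦ a ⊗ b ⟧ℤ = ⟦ a ⟧ℤ * ⟦ b ⟧ℤ

  +⟦⟧≡⟦⟧ℤ : ∀ e → + ⟦ e ⟧ ≡ ⟦ e ⟧ℤ
  +⟦⟧≡⟦⟧ℤ (‵ x)   = refl
  +⟦⟧≡⟦⟧ℤ (a ⊕ b) = trans (pos-+ ⟦ a ⟧ ⟦ b ⟧) (cong₂ _+_ (+⟦⟧≡⟦⟧ℤ a) (+⟦⟧≡⟦⟧ℤ b))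
  +⟦⟧≡⟦⟧ℤ (a ⊗ b) = trans (pos-* ⟦ a ⟧ ⟦ b ⟧) (cong₂ _*_ (+⟦⟧≡⟦⟧ℤ a) (+⟦⟧≡⟦⟧ℤ b))

  ℕ⇒ℤ : ∀ a b → ⟦ a ⟧ ≡ ⟦ b ⟧ → ⟦ a ⟧ℤ ≡ ⟦ b ⟧ℤ
  ℕ⇒ℤ a b eq = trans (sym (+⟦⟧≡⟦⟧ℤ a)) (trans (cong +_ eq) (+⟦⟧≡⟦⟧ℤ b))

  ℤ⇒ℕ : ∀ a b → ⟦ a ⟧ℤ ≡ ⟦ b ⟧ℤ → ⟦ a ⟧ ≡ ⟦ b ⟧
  ℤ⇒ℕ a b eq = +-injective (trans (+⟦⟧≡⟦⟧ℤ a) (trans eq (sym (+⟦⟧≡⟦⟧ℤ b))))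

  x+y≡z⇒x≡z-y : ∀ {x y z : ℤ} → x + y ≡ z → x ≡ z - y
  x+y≡z⇒x≡z-y {x} {y} refl = lemma x y
    where lemma : ∀ x y → x ≡ x + y - y
          lemma = solve-∀

  x+y≡z⇒y≡z-x : ∀ {x y z : ℤ} → x + y ≡ z → y ≡ z - x
  x+y≡z⇒y≡z-x {x} {y} refl = lemma x y
    where lemma : ∀ x y → y ≡ x + y - x
          lemma = solve-∀

  x+y*r≡x : ∀ x y {r} → r ≡ + 0 → x + y * r ≡ x
  x+y*r≡x x y refl = lemma x y
    where lemma : ∀ x y → x + y * + 0 ≡ x
          lemma = solve-∀

  -- The two sides differ by a multiple of  l (f + u) + k - k² - l, which vanishes for a design.
  excess-polynomial-identity : ∀ l k f u E →
    f * u * (l * f * f + k * f - l * f) + l * u * u * ((f - k) * (f - k) - (k - l))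
      + E * (+ 2 * u * (f * k - l * (f + u)) + (f + u) * E)
    ≡ u * ((f * k - (l * u - E)) * (f * k - (l * u - E))) + f * ((l * u - E) * (l * u - E))
      + (f * f * u - l * u * u) * (l * (f + u) + k - k * k - l)
  excess-polynomial-identity = solve-∀

  excess-identityℤ : ∀ (l k f u t n S E W Φ D Q : ℤ) →
    l * (f + u) + k ≡ k * k + l →
    k + t ≡ f → l + n ≡ k → t * t ≡ n + S →
    D + E ≡ l * u → Φ + D ≡ f * k → W + l * (f + u) ≡ f * k → Q + l * f ≡ l * f * f + k * f →
    f * u * Q + l * u * u * S + E * (+ 2 * u * W + (f + u) * E) ≡ u * (Φ * Φ) + f * (D * D)
  excess-identityℤ l k f u t n S E W Φ D Q relation k+t≡f l+n≡k t²≡n+S D+E≡lu Φ+D≡fk W+lv≡fk Q+lf≡ =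
    substituted t n S D Φ W Q
      (x+y≡z⇒y≡z-x k+t≡f) (x+y≡z⇒y≡z-x l+n≡k) (x+y≡z⇒y≡z-x (sym t²≡n+S)) (x+y≡z⇒x≡z-y D+E≡lu)
      (x+y≡z⇒x≡z-y Φ+D≡fk) (x+y≡z⇒x≡z-y W+lv≡fk) (x+y≡z⇒x≡z-y Q+lf≡)
    where
    relation-zero : l * (f + u) + k - k * k - l ≡ + 0
    relation-zero = trans (regroup (l * (f + u) + k) (k * k) l)
      (trans (cong (l * (f + u) + k -_) (sym relation)) (+-inverseʳ (l * (f + u) + k)))
      where regroup : ∀ x c d → x - c - d ≡ x - (c + d)
            regroup = solve-∀
    substituted : ∀ t n S D Φ W Q →
      t ≡ f - k → n ≡ k - l → S ≡ t * t - n → D ≡ l * u - E →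
      Φ ≡ f * k - D → W ≡ f * k - l * (f + u) → Q ≡ l * f * f + k * f - l * f →
      f * u * Q + l * u * u * S + E * (+ 2 * u * W + (f + u) * E) ≡ u * (Φ * Φ) + f * (D * D)
    substituted ._ ._ ._ ._ ._ ._ ._ refl refl refl refl refl refl refl =
      trans (excess-polynomial-identity l k f u E) (x+y*r≡x
        (u * ((f * k - (l * u - E)) * (f * k - (l * u - E))) + f * ((l * u - E) * (l * u - E)))
        (f * f * u - l * u * u) relation-zero)

  excess-identity : ∀ {l k f u t n S E W Φ D Q : ℕ} →
    l ℕ.* (f ℕ.+ u) ℕ.+ k ≡ k ℕ.* k ℕ.+ l →
    k ℕ.+ t ≡ f → l ℕ.+ n ≡ k → t ℕ.* t ≡ n ℕ.+ S →
    D ℕ.+ E ≡ l ℕ.* u → Φ ℕ.+ D ≡ f ℕ.* k → W ℕ.+ l ℕ.* (f ℕ.+ u) ≡ f ℕ.* k →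
    Q ℕ.+ l ℕ.* f ≡ l ℕ.* f ℕ.* f ℕ.+ k ℕ.* f →
    f ℕ.* u ℕ.* Q ℕ.+ l ℕ.* u ℕ.* u ℕ.* S ℕ.+ E ℕ.* (2 ℕ.* u ℕ.* W ℕ.+ (f ℕ.+ u) ℕ.* E)
      ≡ u ℕ.* (Φ ℕ.* Φ) ℕ.+ f ℕ.* (D ℕ.* D)
  excess-identity {l} {k} {f} {u} {t} {n} {S} {E} {W} {Φ} {D} {Q}
                  relation k+t≡f l+n≡k t²≡n+S D+E≡lu Φ+D≡fk W+lv≡fk Q+lf≡ =
    ℤ⇒ℕ (‵ f ⊗ ‵ u ⊗ ‵ Q ⊕ ‵ l ⊗ ‵ u ⊗ ‵ u ⊗ ‵ S ⊕ ‵ E ⊗ (‵ 2 ⊗ ‵ u ⊗ ‵ W ⊕ (‵ f ⊕ ‵ u) ⊗ ‵ E))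
        (‵ u ⊗ (‵ Φ ⊗ ‵ Φ) ⊕ ‵ f ⊗ (‵ D ⊗ ‵ D))
        (excess-identityℤ (+ l) (+ k) (+ f) (+ u) (+ t) (+ n) (+ S) (+ E) (+ W) (+ Φ) (+ D) (+ Q)
          (ℕ⇒ℤ (‵ l ⊗ (‵ f ⊕ ‵ u) ⊕ ‵ k) (‵ k ⊗ ‵ k ⊕ ‵ l) relation)
          (ℕ⇒ℤ (‵ k ⊕ ‵ t) (‵ f) k+t≡f)
          (ℕ⇒ℤ (‵ l ⊕ ‵ n) (‵ k) l+n≡k)
          (ℕ⇒ℤ (‵ t ⊗ ‵ t) (‵ n ⊕ ‵ S) t²≡n+S)
          (ℕ⇒ℤ (‵ D ⊕ ‵ E) (‵ l ⊗ ‵ u) D+E≡lu)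
          (ℕ⇒ℤ (‵ Φ ⊕ ‵ D) (‵ f ⊗ ‵ k) Φ+D≡fk)
          (ℕ⇒ℤ (‵ W ⊕ ‵ l ⊗ (‵ f ⊕ ‵ u)) (‵ f ⊗ ‵ k) W+lv≡fk)
          (ℕ⇒ℤ (‵ Q ⊕ ‵ l ⊗ ‵ f) (‵ l ⊗ ‵ f ⊗ ‵ f ⊕ ‵ k ⊗ ‵ f) Q+lf≡))

open IntegerArithmetic using (excess-identity)

open import Data.Nat using (ℕ; zero; suc; _+_; _*_; _∸_; _^_; _≤_; _<_; _/_; _≤?_; z≤n; s≤s; ∣_-_∣)
open import Data.Nat.Properties hiding (_≟_)
open import Data.Nat.Tactic.RingSolver using (solve-∀)
open import Data.Nat.DivMod using (m*n/n≡m)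
open import Algebra.Properties.Semiring.Sum +-*-semiring
  using (sum; sum-syntax; ∑-comm; ∑-distrib-+; *-distribˡ-sum; *-distribʳ-sum; sum-cong-≗)
open import Data.Bool using (Bool; true; false; _∧_; not; if_then_else_)
open import Data.Bool.Properties using (∧-idem)
open import Data.Fin as Fin using (Fin; _≟_)
import Data.Fin.Properties as Fin
open import Data.Product using (_×_; _,_)
open import Data.Sum using (_⊎_)
open import Data.Empty using (⊥-elim)
open import Function using (_∘_; case_of_)
open import Relation.Nullary using (yes; no)
open import Relation.Nullary.Decidable using (⌊_⌋)

𝟙 : Bool → ℕ
𝟙 b = if b then 1 else 0

𝟙-∧ : ∀ a b → 𝟙 (a ∧ b) ≡ 𝟙 a * 𝟙 b
𝟙-∧ false b = refl
𝟙-∧ true  b = sym (+-identityʳ (𝟙 b))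

𝟙-idem : ∀ b → 𝟙 b * 𝟙 b ≡ 𝟙 b
𝟙-idem false = refl
𝟙-idem true  = refl

𝟙+𝟙-not : ∀ b → 𝟙 b + 𝟙 (not b) ≡ 1
𝟙+𝟙-not false = refl
𝟙+𝟙-not true  = refl

count≡∑𝟙 : ∀ {n} (P : Fin n → Bool) → count P ≡ ∑[ i < n ] 𝟙 (P i)
count≡∑𝟙 {zero}  P = refl
count≡∑𝟙 {suc n} P = cong (𝟙 (P Fin.zero) +_) (count≡∑𝟙 (P ∘ Fin.suc))

∑𝟙*≡count* : ∀ {n} (P : Fin n → Bool) c → ∑[ i < n ] (𝟙 (P i) * c) ≡ count P * c
∑𝟙*≡count* P c = trans (sym (*-distribʳ-sum c (𝟙 ∘ P))) (cong (_* c) (sym (count≡∑𝟙 P)))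

count-cong : ∀ {n} {P Q : Fin n → Bool} → (∀ i → P i ≡ Q i) → count P ≡ count Q
count-cong {P = P} {Q} P≗Q = trans (count≡∑𝟙 P) (trans (sum-cong-≗ (cong 𝟙 ∘ P≗Q)) (sym (count≡∑𝟙 Q)))

∑-const : ∀ {n} c → ∑[ i < n ] c ≡ n * c
∑-const {zero}  c = refl
∑-const {suc n} c = cong (c +_) (∑-const {n} c)

∑-mono-≤ : ∀ {n} {f g : Fin n → ℕ} → (∀ i → f i ≤ g i) → sum f ≤ sum g
∑-mono-≤ {zero}  f≤g = z≤n
∑-mono-≤ {suc n} f≤g = +-mono-≤ (f≤g Fin.zero) (∑-mono-≤ (f≤g ∘ Fin.suc))

∑-split : ∀ {n} (P : Fin n → Bool) (h : Fin n → ℕ) →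
  ∑[ i < n ] (𝟙 (P i) * h i) + ∑[ i < n ] (𝟙 (not (P i)) * h i) ≡ sum h
∑-split P h = trans (sym (∑-distrib-+ (λ i → 𝟙 (P i) * h i) (λ i → 𝟙 (not (P i)) * h i))) (sum-cong-≗ λ i →
  trans (sym (*-distribʳ-+ (h i) (𝟙 (P i)) _)) (trans (cong (_* h i) (𝟙+𝟙-not (P i))) (*-identityˡ (h i))))

count+count-not : ∀ {n} (P : Fin n → Bool) → count P + count (not ∘ P) ≡ n
count+count-not {zero}  P = refl
count+count-not {suc n} P with P Fin.zero
... | true  = cong suc (count+count-not (P ∘ Fin.suc))
... | false = trans (+-suc _ _) (cong suc (count+count-not (P ∘ Fin.suc)))

∑-except-one : ∀ {n} (g μ : Fin n → ℕ) (p : Fin n) {a c : ℕ} →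
  μ p ≡ c → (∀ q → q ≢ p → μ q ≡ a) →
  ∑[ q < n ] (g q * μ q) + g p * a ≡ a * sum g + g p * c
∑-except-one {suc n} g μ Fin.zero {a} {c} μp others = begin
  g₀ * μ Fin.zero + ∑[ q < n ] (g (Fin.suc q) * μ (Fin.suc q)) + g₀ * a
    ≡⟨ cong₂ (λ x y → g₀ * x + y + g₀ * a) μp (sum-cong-≗ λ q → cong (g (Fin.suc q) *_) (others (Fin.suc q) λ ())) ⟩
  g₀ * c + ∑[ q < n ] (g (Fin.suc q) * a) + g₀ * a
    ≡⟨ cong (λ x → g₀ * c + x + g₀ * a)
            (trans (sum-cong-≗ {x = λ q → g (Fin.suc q) * a} λ q → *-comm _ a) (sym (*-distribˡ-sum a (g ∘ Fin.suc)))) ⟩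
  g₀ * c + a * ∑[ q < n ] g (Fin.suc q) + g₀ * a
    ≡⟨ rearrange g₀ c a _ ⟩
  a * (g₀ + ∑[ q < n ] g (Fin.suc q)) + g₀ * c ∎
  where
  open ≡-Reasoning
  g₀ = g Fin.zero
  rearrange : ∀ x c a s → x * c + a * s + x * a ≡ a * (x + s) + x * c
  rearrange = solve-∀
∑-except-one {suc n} g μ (Fin.suc p) {a} {c} μp others = begin
  g₀ * μ Fin.zero + S + g (Fin.suc p) * a ≡⟨ cong (λ x → g₀ * x + S + g (Fin.suc p) * a) (others Fin.zero λ ()) ⟩
  g₀ * a + S + g (Fin.suc p) * a          ≡⟨ +-assoc (g₀ * a) S _ ⟩
  g₀ * a + (S + g (Fin.suc p) * a)        ≡⟨ cong (g₀ * a +_) ih ⟩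
  g₀ * a + (a * S′ + g (Fin.suc p) * c)   ≡⟨ rearrange g₀ a S′ _ ⟩
  a * (g₀ + S′) + g (Fin.suc p) * c       ∎
  where
  open ≡-Reasoning
  g₀ = g Fin.zero
  S = ∑[ q < n ] (g (Fin.suc q) * μ (Fin.suc q))
  S′ = ∑[ q < n ] g (Fin.suc q)
  ih : S + g (Fin.suc p) * a ≡ a * S′ + g (Fin.suc p) * c
  ih = ∑-except-one (g ∘ Fin.suc) (μ ∘ Fin.suc) p μp (λ q q≢p → others (Fin.suc q) (q≢p ∘ Fin.suc-injective))
  rearrange : ∀ x a s y → x * a + (a * s + y) ≡ a * (x + s) + y
  rearrange = solve-∀

∑-two-valued : ∀ {n} (P : Fin n → Bool) (h : Fin n → ℕ) {a b : ℕ} →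
  (∀ i → h i ≡ (if P i then b else a)) →
  sum h + a * count P ≡ a * n + b * count P
∑-two-valued {n} P h {a} {b} h-values = begin
  sum h + a * count P                       ≡⟨ cong (λ x → sum h + a * x) (count≡∑𝟙 P) ⟩
  sum h + a * ∑[ i < n ] 𝟙 (P i)            ≡⟨ cong (sum h +_) (*-distribˡ-sum a (𝟙 ∘ P)) ⟩
  sum h + ∑[ i < n ] (a * 𝟙 (P i))          ≡⟨ sym (∑-distrib-+ h (λ i → a * 𝟙 (P i))) ⟩
  ∑[ i < n ] (h i + a * 𝟙 (P i))            ≡⟨ sum-cong-≗ pointwise ⟩
  ∑[ i < n ] (a + b * 𝟙 (P i))              ≡⟨ ∑-distrib-+ (λ _ → a) (λ i → b * 𝟙 (P i)) ⟩
  ∑[ i < n ] a + ∑[ i < n ] (b * 𝟙 (P i))   ≡⟨ cong₂ _+_ (trans (∑-const {n} a) (*-comm n a))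
                                                         (sym (*-distribˡ-sum b (𝟙 ∘ P))) ⟩
  a * n + b * ∑[ i < n ] 𝟙 (P i)            ≡⟨ cong (λ x → a * n + b * x) (sym (count≡∑𝟙 P)) ⟩
  a * n + b * count P                       ∎
  where
  open ≡-Reasoning
  pointwise : ∀ i → h i + a * 𝟙 (P i) ≡ a + b * 𝟙 (P i)
  pointwise i with P i | h-values i
  ... | true  | hi = trans (cong₂ _+_ hi (*-identityʳ a)) (trans (+-comm b a) (cong (a +_) (sym (*-identityʳ b))))
  ... | false | hi = trans (cong₂ _+_ hi (*-zeroʳ a)) (cong (a +_) (sym (*-zeroʳ b)))

count-mono : ∀ {n} (P Q : Fin n → Bool) → (∀ i → P i ≡ true → Q i ≡ true) → count P ≤ count Q
count-mono P Q P⇒Q = subst₂ _≤_ (sym (count≡∑𝟙 P)) (sym (count≡∑𝟙 Q)) (∑-mono-≤ λ i → 𝟙-mono (P⇒Q i))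
  where
  𝟙-mono : ∀ {a b} → (a ≡ true → b ≡ true) → 𝟙 a ≤ 𝟙 b
  𝟙-mono {false} _ = z≤n
  𝟙-mono {true}  a⇒b rewrite a⇒b refl = ≤-refl

count≤n : ∀ {n} (P : Fin n → Bool) → count P ≤ n
count≤n {zero}  P = z≤n
count≤n {suc n} P with P Fin.zero
... | true  = s≤s (count≤n (P ∘ Fin.suc))
... | false = m≤n⇒m≤1+n (count≤n (P ∘ Fin.suc))

count≡n⇒all : ∀ {n} (P : Fin n → Bool) → count P ≡ n → ∀ i → P i ≡ true
count≡n⇒all {suc n} P count≡n i with P Fin.zero in P₀
count≡n⇒all {suc n} P count≡n Fin.zero    | true  = P₀
count≡n⇒all {suc n} P count≡n (Fin.suc i) | true  = count≡n⇒all (P ∘ Fin.suc) (suc-injective count≡n) i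
count≡n⇒all {suc n} P count≡n i           | false = ⊥-elim (1+n≰n (subst (_≤ n) count≡n (count≤n (P ∘ Fin.suc))))

∑-two-terms≤ : ∀ {n} (h : Fin n → ℕ) {B C : Fin n} → B ≢ C → h B + h C ≤ sum h
∑-two-terms≤ h {Fin.zero}  {Fin.zero}  B≢C = ⊥-elim (B≢C refl)
∑-two-terms≤ h {Fin.zero}  {Fin.suc C} B≢C = +-monoʳ-≤ (h Fin.zero) (term≤sum (h ∘ Fin.suc) C)
  where
  term≤sum : ∀ {n} (h : Fin n → ℕ) C → h C ≤ sum h
  term≤sum h Fin.zero    = m≤m+n _ _
  term≤sum h (Fin.suc C) = m≤n⇒m≤o+n (h Fin.zero) (term≤sum (h ∘ Fin.suc) C)
∑-two-terms≤ h {Fin.suc B} {Fin.zero}  B≢C =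
  subst (_≤ sum h) (+-comm (h Fin.zero) _) (∑-two-terms≤ h (B≢C ∘ sym))
∑-two-terms≤ h {Fin.suc B} {Fin.suc C} B≢C =
  m≤n⇒m≤o+n (h Fin.zero) (∑-two-terms≤ (h ∘ Fin.suc) (B≢C ∘ cong Fin.suc))

∣m-n∣²+2mn≡m²+n² : ∀ m n → ∣ m - n ∣ * ∣ m - n ∣ + 2 * (m * n) ≡ m * m + n * n
∣m-n∣²+2mn≡m²+n² zero    n       = +-identityʳ (n * n)
∣m-n∣²+2mn≡m²+n² (suc m) zero    = cong (λ x → suc m * suc m + 2 * x) (*-zeroʳ (suc m))
∣m-n∣²+2mn≡m²+n² (suc m) (suc n) = begin
  ∣ m - n ∣ * ∣ m - n ∣ + 2 * (suc m * suc n)           ≡⟨ shift (∣ m - n ∣ * ∣ m - n ∣) m n ⟩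
  ∣ m - n ∣ * ∣ m - n ∣ + 2 * (m * n) + 2 * (m + n + 1) ≡⟨ cong (_+ 2 * (m + n + 1)) (∣m-n∣²+2mn≡m²+n² m n) ⟩
  m * m + n * n + 2 * (m + n + 1)                       ≡⟨ expand m n ⟩
  suc m * suc m + suc n * suc n                         ∎
  where
  open ≡-Reasoning
  shift : ∀ d m n → d + 2 * (suc m * suc n) ≡ d + 2 * (m * n) + 2 * (m + n + 1)
  shift = solve-∀
  expand : ∀ m n → m * m + n * n + 2 * (m + n + 1) ≡ suc m * suc m + suc n * suc n
  expand = solve-∀

2mn≤m²+n² : ∀ m n → 2 * (m * n) ≤ m * m + n * n
2mn≤m²+n² m n = subst (2 * (m * n) ≤_) (∣m-n∣²+2mn≡m²+n² m n) (m≤n+m (2 * (m * n)) (∣ m - n ∣ * ∣ m - n ∣))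

cauchy-schwarz : ∀ {n} (w a : Fin n → ℕ) →
  ∑[ i < n ] (w i * a i) * ∑[ i < n ] (w i * a i) ≤ sum w * ∑[ i < n ] (w i * (a i * a i))
cauchy-schwarz {zero}  w a = z≤n
cauchy-schwarz {suc n} w a = begin
  (w₀ * a₀ + s) * (w₀ * a₀ + s)                          ≡⟨ expand w₀ a₀ s ⟩
  w₀ * w₀ * (a₀ * a₀) + w₀ * (2 * a₀ * s) + s * s
    ≤⟨ +-mono-≤ (+-monoʳ-≤ (w₀ * w₀ * (a₀ * a₀)) (*-monoʳ-≤ w₀ (cross-term a₀ s m q ih))) ih ⟩
  w₀ * w₀ * (a₀ * a₀) + w₀ * (q + m * (a₀ * a₀)) + m * q ≡⟨ collect w₀ a₀ m q ⟩
  (w₀ + m) * (w₀ * (a₀ * a₀) + q)                        ∎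
  where
  open ≤-Reasoning
  w₀ = w Fin.zero
  a₀ = a Fin.zero
  s = ∑[ i < n ] (w (Fin.suc i) * a (Fin.suc i))
  m = ∑[ i < n ] w (Fin.suc i)
  q = ∑[ i < n ] (w (Fin.suc i) * (a (Fin.suc i) * a (Fin.suc i)))
  ih : s * s ≤ m * q
  ih = cauchy-schwarz (w ∘ Fin.suc) (a ∘ Fin.suc)
  expand : ∀ w a s → (w * a + s) * (w * a + s) ≡ w * w * (a * a) + w * (2 * a * s) + s * s
  expand = solve-∀
  collect : ∀ w a m q → w * w * (a * a) + w * (q + m * (a * a)) + m * q ≡ (w + m) * (w * (a * a) + q)
  collect = solve-∀
  -- AM-GM applied to m·a and s, then divided by m
  cross-term : ∀ a s m q → s * s ≤ m * q → 2 * a * s ≤ q + m * (a * a)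
  cross-term a zero    m       q _ = subst (_≤ q + m * (a * a)) (sym (*-zeroʳ (2 * a))) z≤n
  cross-term a (suc s) zero    q ()
  cross-term a s       (suc m) q s²≤mq = *-cancelˡ-≤ (suc m) (begin
    suc m * (2 * a * s)                        ≡⟨ regroup (suc m) a s ⟩
    2 * ((suc m * a) * s)                      ≤⟨ 2mn≤m²+n² (suc m * a) s ⟩
    (suc m * a) * (suc m * a) + s * s          ≤⟨ +-monoʳ-≤ _ s²≤mq ⟩
    (suc m * a) * (suc m * a) + suc m * q      ≡⟨ factor (suc m) a q ⟩
    suc m * (q + suc m * (a * a))              ∎)
    where
    regroup : ∀ m a s → m * (2 * a * s) ≡ 2 * ((m * a) * s)
    regroup = solve-∀
    factor : ∀ m a q → (m * a) * (m * a) + m * q ≡ m * (q + m * (a * a))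
    factor = solve-∀

a*x+b*y≡a*y+b*x⇒x≡y : ∀ {a b x y} → a < b → a * x + b * y ≡ a * y + b * x → x ≡ y
a*x+b*y≡a*y+b*x⇒x≡y {a} {b} {x} {y} a<b eq with b ∸ suc a | m+[n∸m]≡n a<b
... | d | refl = sym (*-cancelˡ-≡ y x (suc d) (+-cancelˡ-≡ (a * x + a * y) _ _ (begin
  a * x + a * y + suc d * y        ≡⟨ split a d x y ⟨
  a * x + suc (a + d) * y          ≡⟨ eq ⟩
  a * y + suc (a + d) * x          ≡⟨ split a d y x ⟩
  a * y + a * x + suc d * x        ≡⟨ cong (_+ suc d * x) (+-comm (a * y) (a * x)) ⟩
  a * x + a * y + suc d * x        ∎)))
  where
  open ≡-Reasoning
  split : ∀ a d x y → a * x + suc (a + d) * y ≡ a * x + a * y + suc d * y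
  split = solve-∀

-- In the application f and u are the numbers of fixed and of moved blocks, Φ and D count the fixed
-- points on them, and Q = Σ_B |Fix ∩ B|².
[f∸k]²≤k∸l : ∀ {l k f u Φ D Q : ℕ} → 0 < l → 0 < u → l ≤ k → k ≤ f →
  l * (f + u) + k ≡ k * k + l →
  Φ + D ≡ f * k → D ≤ l * u → Q + l * f ≡ l * f * f + k * f →
  u * (Φ * Φ) + f * (D * D) ≤ f * u * Q →
  (f ∸ k) ^ 2 ≤ k ∸ l
[f∸k]²≤k∸l {l@(suc _)} {k} {f} {u@(suc _)} {Φ} {D} {Q} _ _ l≤k k≤f relation Φ+D≡fk D≤lu Q+lf≡ cauchy
  with (f ∸ k) ^ 2 ≤? k ∸ l
... | yes bound = bound
... | no ¬bound = ⊥-elim (<-irrefl refl (begin-strict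
  f * u * Q                                                      <⟨ m<m+n _ (s≤s z≤n) ⟩
  f * u * Q + l * u * u * suc S                                  ≤⟨ m≤m+n _ _ ⟩
  f * u * Q + l * u * u * suc S + E * (2 * u * W + (f + u) * E)  ≡⟨ identity ⟩
  u * (Φ * Φ) + f * (D * D)                                      ≤⟨ cauchy ⟩
  f * u * Q                                                      ∎))
  where
  open ≤-Reasoning
  t = f ∸ k
  n = k ∸ l
  S = t * t ∸ suc n
  E = l * u ∸ D
  W = f * k ∸ l * (f + u)
  t²≡n+1+S : t * t ≡ n + suc S
  t²≡n+1+S = trans (sym (m+[n∸m]≡n n<t²)) (sym (+-suc n S))
    where
    n<t² : n < t * t
    n<t² = subst (n <_) (cong (t *_) (*-identityʳ t)) (≰⇒> ¬bound)
  lv≤fk : l * (f + u) ≤ f * k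
  lv≤fk = ≤-trans (+-cancelʳ-≤ k _ _ (subst (_≤ k * k + k) (sym relation) (+-monoʳ-≤ (k * k) l≤k)))
                  (*-monoˡ-≤ k k≤f)
  identity : f * u * Q + l * u * u * suc S + E * (2 * u * W + (f + u) * E) ≡ u * (Φ * Φ) + f * (D * D)
  identity = excess-identity {E = E} {W} {Φ} {D} relation (m+[n∸m]≡n k≤f) (m+[n∸m]≡n l≤k) t²≡n+1+S
                                                  (m+[n∸m]≡n D≤lu) Φ+D≡fk (trans (+-comm W _) (m+[n∸m]≡n lv≤fk)) Q+lf≡


module SymmetricDesign {v k lam : ℕ} {I : Incidence v} (𝒟 : IsSymmetricDesign v k lam I)
                       (1<k : 1 < k) (k+1<v : suc k < v) where
  open IsSymmetricDesign 𝒟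

  χ : Fin v → Fin v → ℕ
  χ p B = 𝟙 (I p B)

  replication : Fin v → ℕ
  replication p = count (I p)

  common : Fin v → Fin v → ℕ
  common p q = count (λ B → I p B ∧ I q B)

  common≡∑ : ∀ p q → common p q ≡ ∑[ B < v ] (χ p B * χ q B)
  common≡∑ p q = trans (count≡∑𝟙 (λ B → I p B ∧ I q B)) (sum-cong-≗ λ B → 𝟙-∧ (I p B) (I q B))

  common≡lam : ∀ p q → q ≢ p → common p q ≡ lam
  common≡lam p q q≢p = pairCount p q (q≢p ∘ sym)

  common-diag : ∀ p → common p p ≡ replication p
  common-diag p = count-cong λ B → ∧-idem (I p B)

  ∑-column : ∀ B → ∑[ p < v ] χ p B ≡ k
  ∑-column B = trans (sym (count≡∑𝟙 (λ p → I p B))) (blockSize B)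

  ∑-replication : ∑[ p < v ] replication p ≡ v * k
  ∑-replication = begin
    ∑[ p < v ] replication p        ≡⟨ sum-cong-≗ (λ p → count≡∑𝟙 (I p)) ⟩
    ∑[ p < v ] ∑[ B < v ] χ p B     ≡⟨ ∑-comm χ ⟩
    ∑[ B < v ] ∑[ p < v ] χ p B     ≡⟨ sum-cong-≗ ∑-column ⟩
    ∑[ B < v ] k                    ≡⟨ ∑-const {v} k ⟩
    v * k                           ∎
    where open ≡-Reasoning

  ∑-common : ∀ p → ∑[ q < v ] common p q ≡ k * replication p
  ∑-common p = begin
    ∑[ q < v ] common p q                        ≡⟨ sum-cong-≗ (common≡∑ p) ⟩
    ∑[ q < v ] ∑[ B < v ] (χ p B * χ q B)        ≡⟨ ∑-comm (λ q B → χ p B * χ q B) ⟩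
    ∑[ B < v ] ∑[ q < v ] (χ p B * χ q B)        ≡⟨ sum-cong-≗ (λ B → sym (*-distribˡ-sum (χ p B) (λ q → χ q B))) ⟩
    ∑[ B < v ] (χ p B * ∑[ q < v ] χ q B)        ≡⟨ sum-cong-≗ (λ B → cong (χ p B *_) (∑-column B)) ⟩
    ∑[ B < v ] (χ p B * k)                       ≡⟨ sym (*-distribʳ-sum k (χ p)) ⟩
    ∑[ B < v ] χ p B * k                         ≡⟨ cong (_* k) (sym (count≡∑𝟙 (I p))) ⟩
    replication p * k                            ≡⟨ *-comm (replication p) k ⟩
    k * replication p                            ∎
    where open ≡-Reasoning

  ∑-common+lam : ∀ p → ∑[ q < v ] common p q + lam ≡ lam * v + replication p
  ∑-common+lam p = begin
    ∑[ q < v ] common p q + lam             ≡⟨ cong₂ _+_ (sum-cong-≗ λ q → sym (*-identityˡ (common p q)))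
                                                         (sym (*-identityˡ lam)) ⟩
    ∑[ q < v ] (1 * common p q) + 1 * lam   ≡⟨ ∑-except-one (λ _ → 1) (common p) p (common-diag p) (common≡lam p) ⟩
    lam * ∑[ q < v ] 1 + 1 * replication p  ≡⟨ cong₂ (λ x y → lam * x + y) (trans (∑-const {v} 1) (*-identityʳ v))
                                                                        (*-identityˡ _) ⟩
    lam * v + replication p                 ∎
    where open ≡-Reasoning

  -- (k - 1) r_p = λ (v - 1), so all replication numbers agree
  replication-constant : ∀ p q → replication p ≡ replication q
  replication-constant p q = a*x+b*y≡a*y+b*x⇒x≡y 1<k (+-cancelʳ-≡ lam _ _ (begin
    1 * rp + k * rq + lam            ≡⟨ cong (λ x → x + k * rq + lam) (*-identityˡ rp) ⟩
    rp + k * rq + lam                ≡⟨ regroup rp (k * rq) lam ⟩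
    rp + (k * rq + lam)              ≡⟨ cong (rp +_) (cong (_+ lam) (sym (∑-common q))) ⟩
    rp + (∑[ i < v ] common q i + lam) ≡⟨ cong (rp +_) (∑-common+lam q) ⟩
    rp + (lam * v + rq)              ≡⟨ swap rp (lam * v) rq ⟩
    rq + (lam * v + rp)              ≡⟨ cong (rq +_) (sym (∑-common+lam p)) ⟩
    rq + (∑[ i < v ] common p i + lam) ≡⟨ cong (rq +_) (cong (_+ lam) (∑-common p)) ⟩
    rq + (k * rp + lam)              ≡⟨ sym (regroup rq (k * rp) lam) ⟩
    rq + k * rp + lam                ≡⟨ cong (λ x → x + k * rp + lam) (sym (*-identityˡ rq)) ⟩
    1 * rq + k * rp + lam            ∎))
    where
    open ≡-Reasoning
    rp = replication p
    rq = replication q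
    regroup : ∀ a b c → a + b + c ≡ a + (b + c)
    regroup = solve-∀
    swap : ∀ a b c → a + (b + c) ≡ c + (b + a)
    swap = solve-∀

  replication≡k : ∀ p → replication p ≡ k
  replication≡k p = *-cancelˡ-≡ (replication p) k v {{Fin.nonZeroIndex p}} (begin
    v * replication p                   ≡⟨ sym (∑-const {v} (replication p)) ⟩
    ∑[ q < v ] replication p            ≡⟨ sum-cong-≗ (λ q → replication-constant p q) ⟩
    ∑[ q < v ] replication q            ≡⟨ ∑-replication ⟩
    v * k                               ∎)
    where open ≡-Reasoning

  lam*v+k≡k*k+lam : lam * v + k ≡ k * k + lam
  lam*v+k≡k*k+lam = begin
    lam * v + k                           ≡⟨ cong (lam * v +_) (sym (replication≡k p₀)) ⟩
    lam * v + replication p₀              ≡⟨ sym (∑-common+lam p₀) ⟩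
    ∑[ q < v ] common p₀ q + lam          ≡⟨ cong (_+ lam) (trans (∑-common p₀) (cong (k *_) (replication≡k p₀))) ⟩
    k * k + lam                           ∎
    where
    open ≡-Reasoning
    p₀ : Fin v
    p₀ = Fin.fromℕ< (≤-trans (s≤s z≤n) k+1<v)

  lam<k : lam < k
  lam<k with k ≤? lam
  ... | no k≰lam = ≰⇒> k≰lam
  ... | yes k≤lam = ⊥-elim (<-irrefl (sym lam*v+k≡k*k+lam) (begin-strict
    k * k + lam                   <⟨ +-monoʳ-< (k * k) (m<m+n lam (≤-trans (s≤s z≤n) 1<k)) ⟩
    k * k + (lam + k)             ≤⟨ +-monoˡ-≤ (lam + k) (*-monoʳ-≤ k k≤lam) ⟩
    k * lam + (lam + k)           ≤⟨ +-monoʳ-≤ (k * lam) (+-monoʳ-≤ lam (m≤m+n k lam)) ⟩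
    k * lam + (lam + (k + lam))   ≡⟨ regroup k lam ⟩
    lam * suc (suc k) + k         ≤⟨ +-monoˡ-≤ k (*-monoʳ-≤ lam k+1<v) ⟩
    lam * v + k                   ∎))
    where
    open ≤-Reasoning
    regroup : ∀ k l → k * l + (l + (k + l)) ≡ l * suc (suc k) + k
    regroup = solve-∀

  hits : (Fin v → Bool) → Fin v → ℕ
  hits S B = count (λ p → S p ∧ I p B)

  module _ (S : Fin v → Bool) where
    private
      σ : Fin v → ℕ
      σ p = 𝟙 (S p)

    hits≡∑ : ∀ B → hits S B ≡ ∑[ p < v ] (σ p * χ p B)
    hits≡∑ B = trans (count≡∑𝟙 (λ p → S p ∧ I p B)) (sum-cong-≗ λ p → 𝟙-∧ (S p) (I p B))

    ∑-hits : ∑[ B < v ] hits S B ≡ k * count S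
    ∑-hits = begin
      ∑[ B < v ] hits S B                     ≡⟨ sum-cong-≗ hits≡∑ ⟩
      ∑[ B < v ] ∑[ p < v ] (σ p * χ p B)     ≡⟨ ∑-comm (λ B p → σ p * χ p B) ⟩
      ∑[ p < v ] ∑[ B < v ] (σ p * χ p B)     ≡⟨ sum-cong-≗ (λ p → sym (*-distribˡ-sum (σ p) (χ p))) ⟩
      ∑[ p < v ] (σ p * ∑[ B < v ] χ p B)     ≡⟨ sum-cong-≗ (λ p → cong (σ p *_) (row p)) ⟩
      ∑[ p < v ] (σ p * k)                    ≡⟨ ∑𝟙*≡count* S k ⟩
      count S * k                             ≡⟨ *-comm (count S) k ⟩
      k * count S                             ∎
      where
      open ≡-Reasoning
      row : ∀ p → ∑[ B < v ] χ p B ≡ k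
      row p = trans (sym (count≡∑𝟙 (I p))) (replication≡k p)

    ∑-hits²≡∑-common : ∑[ B < v ] (hits S B * hits S B) ≡ ∑[ p < v ] (σ p * ∑[ q < v ] (σ q * common p q))
    ∑-hits²≡∑-common = begin
      ∑[ B < v ] (hits S B * hits S B)
        ≡⟨ sum-cong-≗ (λ B → cong₂ _*_ (hits≡∑ B) (hits≡∑ B)) ⟩
      ∑[ B < v ] (∑[ p < v ] (σ p * χ p B) * ∑[ q < v ] (σ q * χ q B))
        ≡⟨ sum-cong-≗ (λ B → *-distribʳ-sum _ (λ p → σ p * χ p B)) ⟩
      ∑[ B < v ] ∑[ p < v ] (σ p * χ p B * ∑[ q < v ] (σ q * χ q B))
        ≡⟨ sum-cong-≗ (λ B → sum-cong-≗ λ p → *-distribˡ-sum (σ p * χ p B) (λ q → σ q * χ q B)) ⟩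
      ∑[ B < v ] ∑[ p < v ] ∑[ q < v ] (σ p * χ p B * (σ q * χ q B))
        ≡⟨ ∑-comm (λ B p → ∑[ q < v ] (σ p * χ p B * (σ q * χ q B))) ⟩
      ∑[ p < v ] ∑[ B < v ] ∑[ q < v ] (σ p * χ p B * (σ q * χ q B))
        ≡⟨ sum-cong-≗ (λ p → ∑-comm (λ B q → σ p * χ p B * (σ q * χ q B))) ⟩
      ∑[ p < v ] ∑[ q < v ] ∑[ B < v ] (σ p * χ p B * (σ q * χ q B))
        ≡⟨ sum-cong-≗ (λ p → sum-cong-≗ λ q → sum-cong-≗ λ B → regroup (σ p) (χ p B) (σ q) (χ q B)) ⟩
      ∑[ p < v ] ∑[ q < v ] ∑[ B < v ] (σ p * (σ q * (χ p B * χ q B)))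
        ≡⟨ sum-cong-≗ (λ p → sum-cong-≗ λ q → pull-out p q) ⟩
      ∑[ p < v ] ∑[ q < v ] (σ p * (σ q * common p q))
        ≡⟨ sum-cong-≗ (λ p → sym (*-distribˡ-sum (σ p) (λ q → σ q * common p q))) ⟩
      ∑[ p < v ] (σ p * ∑[ q < v ] (σ q * common p q)) ∎
      where
      open ≡-Reasoning
      regroup : ∀ a b c d → (a * b) * (c * d) ≡ a * (c * (b * d))
      regroup = solve-∀
      pull-out : ∀ p q → ∑[ B < v ] (σ p * (σ q * (χ p B * χ q B))) ≡ σ p * (σ q * common p q)
      pull-out p q = begin
        ∑[ B < v ] (σ p * (σ q * (χ p B * χ q B))) ≡⟨ *-distribˡ-sum (σ p) (λ B → σ q * (χ p B * χ q B)) ⟨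
        σ p * ∑[ B < v ] (σ q * (χ p B * χ q B))   ≡⟨ cong (σ p *_) (*-distribˡ-sum (σ q) (λ B → χ p B * χ q B)) ⟨
        σ p * (σ q * ∑[ B < v ] (χ p B * χ q B))   ≡⟨ cong (λ x → σ p * (σ q * x)) (common≡∑ p q) ⟨
        σ p * (σ q * common p q)                   ∎

    ∑-hits² : ∑[ B < v ] (hits S B * hits S B) + lam * count S ≡ lam * count S * count S + k * count S
    ∑-hits² = begin
      ∑[ B < v ] (hits S B * hits S B) + lam * count S
        ≡⟨ cong₂ _+_ ∑-hits²≡∑-common (trans (*-comm lam (count S)) (sym (∑𝟙*≡count* S lam))) ⟩
      ∑[ p < v ] (σ p * X p) + ∑[ p < v ] (σ p * lam)
        ≡⟨ sym (∑-distrib-+ (λ p → σ p * X p) (λ p → σ p * lam)) ⟩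
      ∑[ p < v ] (σ p * X p + σ p * lam)
        ≡⟨ sum-cong-≗ (λ p → trans (cong (λ x → σ p * X p + x * lam) (sym (𝟙-idem (S p)))) (factor (σ p) (X p) lam)) ⟩
      ∑[ p < v ] (σ p * (X p + σ p * lam))
        ≡⟨ sum-cong-≗ (λ p → cong (σ p *_) (X+σλ p)) ⟩
      ∑[ p < v ] (σ p * (lam * count S + σ p * k))
        ≡⟨ sum-cong-≗ (λ p → trans (*-distribˡ-+ (σ p) _ _)
                                   (cong (σ p * (lam * count S) +_) (idem (σ p) k (𝟙-idem (S p))))) ⟩
      ∑[ p < v ] (σ p * (lam * count S) + σ p * k)
        ≡⟨ ∑-distrib-+ (λ p → σ p * (lam * count S)) (λ p → σ p * k) ⟩
      ∑[ p < v ] (σ p * (lam * count S)) + ∑[ p < v ] (σ p * k)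
        ≡⟨ cong₂ _+_ (∑𝟙*≡count* S (lam * count S)) (∑𝟙*≡count* S k) ⟩
      count S * (lam * count S) + count S * k
        ≡⟨ reorder (count S) lam k ⟩
      lam * count S * count S + k * count S  ∎
      where
      open ≡-Reasoning
      X : Fin v → ℕ
      X p = ∑[ q < v ] (σ q * common p q)
      X+σλ : ∀ p → X p + σ p * lam ≡ lam * count S + σ p * k
      X+σλ p = trans (∑-except-one σ (common p) p (trans (common-diag p) (replication≡k p)) (common≡lam p))
                     (cong (λ x → lam * x + σ p * k) (sym (count≡∑𝟙 S)))
      factor : ∀ s x l → s * x + s * s * l ≡ s * (x + s * l)
      factor = solve-∀
      idem : ∀ s c → s * s ≡ s → s * (s * c) ≡ s * c
      idem s c s²≡s = trans (sym (*-assoc s s c)) (cong (_* c) s²≡s)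
      reorder : ∀ n l k → n * (l * n) + n * k ≡ l * n * n + k * n
      reorder = solve-∀

  meet : Fin v → Fin v → ℕ
  meet B C = count (λ p → I p B ∧ I p C)

  meet≡∑ : ∀ B C → meet B C ≡ ∑[ p < v ] (χ p B * χ p C)
  meet≡∑ B C = trans (count≡∑𝟙 (λ p → I p B ∧ I p C)) (sum-cong-≗ λ p → 𝟙-∧ (I p B) (I p C))

  meet-diag : ∀ B → meet B B ≡ k
  meet-diag B = trans (count-cong λ p → ∧-idem (I p B)) (blockSize B)

  -- Σ_C (|B ∩ C| - λ)² = (k - λ)², and the term C = B alone already contributes (k - λ)²
  meet≡lam : ∀ {B C} → B ≢ C → meet B C ≡ lam
  meet≡lam {B} {C} B≢C = ∣m-n∣≡0⇒m≡n (m*m≡0⇒m≡0 (n≤0⇒n≡0 (+-cancelˡ-≤ (dev B) (dev C) 0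
    (subst (dev B + dev C ≤_) (trans ∑dev≡devB (sym (+-identityʳ (dev B)))) (∑-two-terms≤ dev B≢C)))))
    where
    open ≡-Reasoning
    S = λ p → I p B
    h = hits S
    dev : Fin v → ℕ
    dev C = ∣ h C - lam ∣ * ∣ h C - lam ∣
    m*m≡0⇒m≡0 : ∀ {m} → m * m ≡ 0 → m ≡ 0
    m*m≡0⇒m≡0 {zero} _ = refl
    |S|≡k : count S ≡ k
    |S|≡k = blockSize B
    ∑h≡k*k : sum h ≡ k * k
    ∑h≡k*k = trans (∑-hits S) (cong (k *_) |S|≡k)
    ∑h²+lam*k : ∑[ C < v ] (h C * h C) + lam * k ≡ lam * k * k + k * k
    ∑h²+lam*k = subst (λ n → ∑[ C < v ] (h C * h C) + lam * n ≡ lam * n * n + k * n) |S|≡k (∑-hits² S)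
    ∑dev+2kλ≡ : sum dev + 2 * (k * k * lam) ≡ ∑[ C < v ] (h C * h C) + v * (lam * lam)
    ∑dev+2kλ≡ = begin
      sum dev + 2 * (k * k * lam)                     ≡⟨ cong (λ x → sum dev + 2 * (x * lam)) (sym ∑h≡k*k) ⟩
      sum dev + 2 * (sum h * lam)                     ≡⟨ cong (λ x → sum dev + 2 * x) (*-distribʳ-sum lam h) ⟩
      sum dev + 2 * ∑[ C < v ] (h C * lam)            ≡⟨ cong (sum dev +_) (*-distribˡ-sum 2 (λ C → h C * lam)) ⟩
      sum dev + ∑[ C < v ] (2 * (h C * lam))          ≡⟨ sym (∑-distrib-+ dev (λ C → 2 * (h C * lam))) ⟩
      ∑[ C < v ] (dev C + 2 * (h C * lam))            ≡⟨ sum-cong-≗ (λ C → ∣m-n∣²+2mn≡m²+n² (h C) lam) ⟩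
      ∑[ C < v ] (h C * h C + lam * lam)              ≡⟨ ∑-distrib-+ (λ C → h C * h C) (λ _ → lam * lam) ⟩
      ∑[ C < v ] (h C * h C) + ∑[ C < v ] (lam * lam) ≡⟨ cong (∑[ C < v ] (h C * h C) +_) (∑-const {v} (lam * lam)) ⟩
      ∑[ C < v ] (h C * h C) + v * (lam * lam)        ∎
    ∑dev+2kλ : sum dev + 2 * (k * lam) ≡ k * k + lam * lam
    ∑dev+2kλ = +-cancelˡ-≡ (2 * (k * k * lam)) _ _ (begin
      2 * (k * k * lam) + (sum dev + 2 * (k * lam))           ≡⟨ shuffle₁ (sum dev) k lam ⟩
      sum dev + 2 * (k * k * lam) + lam * k + lam * k         ≡⟨ cong (λ x → x + lam * k + lam * k) ∑dev+2kλ≡ ⟩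
      Y + v * (lam * lam) + lam * k + lam * k                 ≡⟨ shuffle₂ Y v lam k ⟩
      (Y + lam * k) + lam * (lam * v + k)                     ≡⟨ cong₂ (λ x y → x + lam * y) ∑h²+lam*k lam*v+k≡k*k+lam ⟩
      (lam * k * k + k * k) + lam * (k * k + lam)             ≡⟨ shuffle₃ lam k ⟩
      2 * (k * k * lam) + (k * k + lam * lam)                 ∎)
      where
      Y = ∑[ C < v ] (h C * h C)
      shuffle₁ : ∀ d k l → 2 * (k * k * l) + (d + 2 * (k * l)) ≡ d + 2 * (k * k * l) + l * k + l * k
      shuffle₁ = solve-∀
      shuffle₂ : ∀ y v l k → y + v * (l * l) + l * k + l * k ≡ (y + l * k) + l * (l * v + k)
      shuffle₂ = solve-∀
      shuffle₃ : ∀ l k → (l * k * k + k * k) + l * (k * k + l) ≡ 2 * (k * k * l) + (k * k + l * l)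
      shuffle₃ = solve-∀
    devB+2kλ : dev B + 2 * (k * lam) ≡ k * k + lam * lam
    devB+2kλ = trans (cong (λ x → ∣ x - lam ∣ * ∣ x - lam ∣ + 2 * (k * lam)) (meet-diag B))
                     (∣m-n∣²+2mn≡m²+n² k lam)
    ∑dev≡devB : sum dev ≡ dev B
    ∑dev≡devB = +-cancelʳ-≡ (2 * (k * lam)) _ _ (trans ∑dev+2kλ (sym devB+2kλ))

  module _ (γ : Aut I) where
    fixedPoint : Fin v → Bool
    fixedPoint p = ⌊ pt γ p ≟ p ⌋

    fixedBlock : Fin v → Bool
    fixedBlock B = ⌊ blk γ B ≟ B ⌋

    common-with-image : ∀ p → common p (pt γ p) ≡ (if fixedPoint p then k else lam)
    common-with-image p with pt γ p ≟ p
    ... | yes γp≡p = trans (cong (common p) γp≡p) (trans (common-diag p) (replication≡k p))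
    ... | no  γp≢p = pairCount p (pt γ p) (γp≢p ∘ sym)

    meet-with-preimage : ∀ B → meet B (blkInv γ B) ≡ (if fixedBlock B then k else lam)
    meet-with-preimage B with blk γ B ≟ B
    ... | yes γB≡B = trans (cong (meet B) (trans (cong (blkInv γ) (sym γB≡B)) (blk-inv₂ γ B))) (meet-diag B)
    ... | no  γB≢B = meet≡lam (λ B≡γ⁻¹B → γB≢B (trans (cong (blk γ) B≡γ⁻¹B) (blk-inv₁ γ B)))

    -- both sides count the flags (p, B) with p, γ p ∈ B
    ∑-common-with-image : ∑[ p < v ] common p (pt γ p) ≡ ∑[ B < v ] meet B (blkInv γ B)
    ∑-common-with-image = begin
      ∑[ p < v ] common p (pt γ p)                              ≡⟨ sum-cong-≗ (λ p → common≡∑ p (pt γ p)) ⟩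
      ∑[ p < v ] ∑[ B < v ] (χ p B * χ (pt γ p) B)
        ≡⟨ sum-cong-≗ (λ p → sum-cong-≗ λ B → cong (λ b → χ p B * 𝟙 b) (image-incidence p B)) ⟩
      ∑[ p < v ] ∑[ B < v ] (χ p B * χ p (blkInv γ B))          ≡⟨ ∑-comm (λ p B → χ p B * χ p (blkInv γ B)) ⟩
      ∑[ B < v ] ∑[ p < v ] (χ p B * χ p (blkInv γ B))          ≡⟨ sum-cong-≗ (λ B → sym (meet≡∑ B (blkInv γ B))) ⟩
      ∑[ B < v ] meet B (blkInv γ B)                            ∎
      where
      open ≡-Reasoning
      image-incidence : ∀ p B → I (pt γ p) B ≡ I p (blkInv γ B)
      image-incidence p B = trans (cong (I (pt γ p)) (sym (blk-inv₁ γ B))) (preserves γ p (blkInv γ B))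

    fixedPoints≡fixedBlocks : count fixedPoint ≡ count fixedBlock
    fixedPoints≡fixedBlocks = a*x+b*y≡a*y+b*x⇒x≡y lam<k (+-cancelˡ-≡ T _ _ (begin
      T + (lam * f + k * f′)        ≡⟨ sym (+-assoc T (lam * f) (k * f′)) ⟩
      T + lam * f + k * f′          ≡⟨ cong (_+ k * f′) (∑-two-valued fixedPoint _ common-with-image) ⟩
      lam * v + k * f + k * f′      ≡⟨ swap (lam * v) (k * f) (k * f′) ⟩
      lam * v + k * f′ + k * f      ≡⟨ cong (_+ k * f) (sym (∑-two-valued fixedBlock _ meet-with-preimage)) ⟩
      U + lam * f′ + k * f          ≡⟨ cong (λ x → x + lam * f′ + k * f) (sym ∑-common-with-image) ⟩
      T + lam * f′ + k * f          ≡⟨ +-assoc T (lam * f′) (k * f) ⟩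
      T + (lam * f′ + k * f)        ∎))
      where
      open ≡-Reasoning
      T = ∑[ p < v ] common p (pt γ p)
      U = ∑[ B < v ] meet B (blkInv γ B)
      f = count fixedPoint
      f′ = count fixedBlock
      swap : ∀ a b c → a + b + c ≡ a + c + b
      swap = solve-∀

    fixed-points-on-moved-block : ∀ B → fixedBlock B ≡ false → hits fixedPoint B ≤ lam
    fixed-points-on-moved-block B B-moved =
      subst (hits fixedPoint B ≤_) (meet≡lam B≢γB) (count-mono _ _ on-image)
      where
      B≢γB : B ≢ blk γ B
      B≢γB B≡γB with blk γ B ≟ B
      ... | yes _   = case B-moved of λ ()
      ... | no γB≢B = γB≢B (sym B≡γB)
      on-image : ∀ p → (fixedPoint p ∧ I p B) ≡ true → (I p B ∧ I p (blk γ B)) ≡ true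
      on-image p fixed∧p∈B with pt γ p ≟ p
      ... | yes γp≡p = cong₂ _∧_ fixed∧p∈B
                         (trans (cong (λ q → I q (blk γ B)) (sym γp≡p)) (trans (preserves γ p B) fixed∧p∈B))
      ... | no  _    = case fixed∧p∈B of λ ()

    movedBlocks : ℕ
    movedBlocks = count (not ∘ fixedBlock)

    ∑fixed ∑moved : (Fin v → ℕ) → ℕ
    ∑fixed h = ∑[ B < v ] (𝟙 (fixedBlock B) * h B)
    ∑moved h = ∑[ B < v ] (𝟙 (not (fixedBlock B)) * h B)

    fixCount+movedBlocks≡v : fixCount γ + movedBlocks ≡ v
    fixCount+movedBlocks≡v = trans (cong (_+ movedBlocks) fixedPoints≡fixedBlocks) (count+count-not fixedBlock)

    0<movedBlocks : NonIdentity γ → 0 < movedBlocks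
    0<movedBlocks γ≢1 = n≢0⇒n>0 λ u≡0 → γ≢1 λ p → fixed p (count≡n⇒all fixedPoint (all-fixed u≡0) p)
      where
      all-fixed : movedBlocks ≡ 0 → fixCount γ ≡ v
      all-fixed u≡0 = trans (sym (+-identityʳ _)) (trans (cong (fixCount γ +_) (sym u≡0)) fixCount+movedBlocks≡v)
      fixed : ∀ p → fixedPoint p ≡ true → pt γ p ≡ p
      fixed p _ with pt γ p ≟ p
      fixed p _  | yes γp≡p = γp≡p
      fixed p () | no  _

    ∑moved-hits≤ : ∑moved (hits fixedPoint) ≤ lam * movedBlocks
    ∑moved-hits≤ = subst (∑moved (hits fixedPoint) ≤_)
                         (trans (∑𝟙*≡count* (not ∘ fixedBlock) lam) (*-comm movedBlocks lam)) (∑-mono-≤ moved)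
      where
      moved : ∀ B → 𝟙 (not (fixedBlock B)) * hits fixedPoint B ≤ 𝟙 (not (fixedBlock B)) * lam
      moved B with fixedBlock B in B-fixed
      ... | true  = z≤n
      ... | false = +-monoˡ-≤ 0 (fixed-points-on-moved-block B B-fixed)

    cauchy-schwarz-fixed+moved : ∀ a →
      movedBlocks * (∑fixed a * ∑fixed a) + fixCount γ * (∑moved a * ∑moved a)
        ≤ fixCount γ * movedBlocks * ∑[ B < v ] (a B * a B)
    cauchy-schwarz-fixed+moved a = begin
      u * (∑fixed a * ∑fixed a) + f * (∑moved a * ∑moved a)  ≤⟨ +-mono-≤ (*-monoʳ-≤ u on-fixed) (*-monoʳ-≤ f on-moved) ⟩
      u * (f * ∑fixed a²) + f * (u * ∑moved a²)              ≡⟨ collect u f (∑fixed a²) (∑moved a²) ⟩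
      f * u * (∑fixed a² + ∑moved a²)                        ≡⟨ cong (f * u *_) (∑-split fixedBlock a²) ⟩
      f * u * ∑[ B < v ] (a B * a B)                         ∎
      where
      open ≤-Reasoning
      f = fixCount γ
      u = movedBlocks
      a² = λ B → a B * a B
      on-fixed : ∑fixed a * ∑fixed a ≤ f * ∑fixed a²
      on-fixed = subst (λ n → ∑fixed a * ∑fixed a ≤ n * ∑fixed a²)
                   (trans (sym (count≡∑𝟙 fixedBlock)) (sym fixedPoints≡fixedBlocks))
                   (cauchy-schwarz (𝟙 ∘ fixedBlock) a)
      on-moved : ∑moved a * ∑moved a ≤ u * ∑moved a²
      on-moved = subst (λ n → ∑moved a * ∑moved a ≤ n * ∑moved a²) (sym (count≡∑𝟙 (not ∘ fixedBlock)))
                   (cauchy-schwarz (𝟙 ∘ not ∘ fixedBlock) a)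
      collect : ∀ u f q₁ q₂ → u * (f * q₁) + f * (u * q₂) ≡ f * u * (q₁ + q₂)
      collect = solve-∀

    fixCount-bound : 0 < lam → NonIdentity γ → (fixCount γ ∸ k) ^ 2 ≤ k ∸ lam
    fixCount-bound 0<lam γ≢1 with k ≤? fixCount γ
    ... | no  k≰f = subst (λ x → x ^ 2 ≤ k ∸ lam) (sym (m≤n⇒m∸n≡0 (<⇒≤ (≰⇒> k≰f)))) z≤n
    ... | yes k≤f = [f∸k]²≤k∸l 0<lam (0<movedBlocks γ≢1) (<⇒≤ lam<k) k≤f
      (subst (λ n → lam * n + k ≡ k * k + lam) (sym fixCount+movedBlocks≡v) lam*v+k≡k*k+lam)
      (trans (∑-split fixedBlock (hits fixedPoint)) (trans (∑-hits fixedPoint) (*-comm k (fixCount γ))))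
      ∑moved-hits≤ (∑-hits² fixedPoint) (cauchy-schwarz-fixed+moved (hits fixedPoint))

x²≤y²⇒x≤y : ∀ {x y} → x ^ 2 ≤ y ^ 2 → x ≤ y
x²≤y²⇒x≤y x²≤y² = ≮⇒≥ λ y<x → <⇒≱ (^-monoˡ-< 2 y<x) x²≤y²

lemma2p6 : (v k lam c d : ℕ) (I : Incidence v) →
    IsSymmetricDesign v k lam I → NonTrivial v k →
    lam * (lam ∸ 3) < 2 * k → 10 < lam →
    (G : Aut I → Set) → IsSubgroup G → FlagTransitive G →
    (cls : Fin v → Fin d) → IsPartition v c d cls → GInvariant G cls →
    MeetsIn0or2 I cls →
    (Type1 v k lam c d ⊎ Type2 v k lam c d) →
    (Δ : Fin d) (γ : Aut I) → InPointwiseStab G cls Δ γ → NonIdentity γ →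
    (Type1 v k lam c d → fixCount γ ≤ (lam + 2) * lam) ×
    (Type2 v k lam c d →
      LeqPlusSqrt (fixCount γ) (lam * lam / 2) (lam * lam / 2 ∸ lam))
lemma2p6 v k lam c d I 𝒟 (2<k , k+1<v) _ 10<lam _ _ _ _ _ _ _ _ _ γ _ γ≢1 = type1 , type2
  where
  open SymmetricDesign 𝒟 (<⇒≤ 2<k) k+1<v using (fixCount-bound)
  bound : (fixCount γ ∸ k) ^ 2 ≤ k ∸ lam
  bound = fixCount-bound γ (≤-trans (s≤s z≤n) 10<lam) γ≢1

  type1 : Type1 v k lam c d → fixCount γ ≤ (lam + 2) * lam
  type1 (_ , k≡ , _) = begin
    fixCount γ                ≤⟨ m≤n+m∸n (fixCount γ) k ⟩
    k + (fixCount γ ∸ k)      ≤⟨ +-monoʳ-≤ k (x²≤y²⇒x≤y (subst ((fixCount γ ∸ k) ^ 2 ≤_) k∸lam≡lam² bound)) ⟩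
    k + lam                   ≡⟨ cong (_+ lam) k≡ ⟩
    lam * (lam + 1) + lam     ≡⟨ expand lam ⟩
    (lam + 2) * lam           ∎
    where
    open ≤-Reasoning
    expand : ∀ l → l * (l + 1) + l ≡ (l + 2) * l
    expand = solve-∀
    k∸lam≡lam² : k ∸ lam ≡ lam ^ 2
    k∸lam≡lam² = trans (cong (_∸ lam) (trans k≡ (split lam))) (m+n∸m≡n lam (lam ^ 2))
      where split : ∀ l → l * (l + 1) ≡ l + l * (l * 1)
            split = solve-∀

  type2 : Type2 v k lam c d → LeqPlusSqrt (fixCount γ) (lam * lam / 2) (lam * lam / 2 ∸ lam)
  type2 (_ , 2k≡lam² , _) = subst (λ x → (fixCount γ ∸ x) ^ 2 ≤ x ∸ lam) (sym lam²/2≡k) bound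
    where
    lam²/2≡k : lam * lam / 2 ≡ k
    lam²/2≡k = trans (cong (_/ 2) (trans (sym 2k≡lam²) (*-comm 2 k))) (m*n/n≡m k 2)
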